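{- Let $G$ be a chain graph and let $\mathcal{H}$ be its canonical LWF DAH. Then (i) for each vertex $v\in V(G)=V(\mathcal{H})$, $nb_G(v)=nb_{\mathcal{H}}(v)$ and $pa_G(v)=pa_{\mathcal{H}}(v)$; (ii) $G$ is the shadow of $\mathcal{H}$; (iii) $\mathcal{H}$ is a directed acyclic hypergraph.
   Context: A chain graph $G$ on a finite vertex set $V$ has edges that are either undirected ($u-w$) or directed ($u\to w$), and contains no partially directed cycle (a cycle of distinct vertices, each step following an undirected edge or a directed edge in its direction, with at least one directed step). In $G$, $pa_G(v)=\{u:u\to v\}$, $nb_G(v)=\{u:u-v\}$, the children of $v$ are $\{w: v\to w\}$; the chain components of $G$ are the connected components of the graph of undirected edges; for $\tau\subseteq V$, $bd(\tau)=\bigcup_{v\in\tau}(pa(v)\cup nb(v))\setminus\tau$ and $cl(\tau)=bd(\tau)\cup\tau$. A directed hypergraph on $V$ is a set of hyperedges $h=(T(h),H(h))$ with $T(h),H(h)\subseteq V$ disjoint, possibly empty. For distinct $u,v$: $u$ is a parent of $v$ in $\mathcal{H}$ if some $h$ has $u\in T(h), v\in H(h)$; $u,v$ are neighbors in $\mathcal{H}$ if some $h$ has $\{u,v\}\subseteq H(h)$. A DAH is a directed hypergraph with no partially directed cycle (a cyclic sequence $v_1,\dots,v_k,v_1$ with each $v_i$ a neighbor or parent of $v_{i+1}$ and at least one parent step). The shadow of $\mathcal{H}$ is the graph on $V$ with $u-w$ for each co-head pair and $x\to y$ whenever $x\in T(h),y\in H(h)$ for some $h$. For $S\subseteq V$,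 $\mathcal{H}_S$ is the hypergraph on $S$ with hyperedges $h$ of $\mathcal{H}$ such that $T(h)\cup H(h)\subseteq S$. Canonical LWF DAH of $G$: $V(\mathcal{H})=V(G)$, with hyperedges built in two phases. Phase I: for each $v\in V$, let $S_v$ be its set of children and $G'$ the graph on $S_v$ formed by the undirected edges of $G$ among $S_v$; for each maximal clique $K$ of $G'$ add the hyperedge $(\{v\},K)$. Let $\mathcal{H}'$ be the result; then for every maximal clique $K$ of the undirected part of $G$ (all edges undirected) such that $K\not\subseteq H(h)$ for every $h\in E(\mathcal{H}')$, add $(\emptyset,K)$. Phase II: let $\mathcal{H}'$ be the hypergraph from Phase I and $\mathcal{D}$ the chain components of $G$. For $\tau\in\mathcal{D}$ let $\mathcal{H}^*_\tau$ be the set of hyperedges $h$ of $\mathcal{H}'_{cl(\tau)}$ with $H(h)\cap\tau\ne\emptyset$. Then $E(\mathcal{H})=\bigcup_{\tau\in\mathcal{D}}\Big\{\Big(\bigcup_{h\in\mathcal{H}^*_\tau,\,B\subseteq H(h)}T(h),\;B\Big): B=\bigcap_{h\in\mathcal{F}}H(h),\ \mathcal{F}\subseteq\mathcal{H}^*_\tau\Big\}$. -}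

module Defs where

open import Data.Nat using (ℕ)
open import Data.Fin using (Fin)
open import Data.Bool using (Bool; true; false; T)
open import Data.List using (List; []; _∷_)
open import Data.List.Relation.Unary.All using (All)
open import Data.List.Relation.Unary.Any using (Any)
open import Data.List.Relation.Unary.Unique.Propositional using (Unique)
open import Data.Product using (_×_; _,_; Σ; ∃; proj₁; proj₂)
open import Data.Sum using (_⊎_)
open import Data.Empty using () renaming (⊥ to Empty)
open import Data.Unit using () renaming (⊤ to Unit)
open import Relation.Nullary using (¬_)
open import Relation.Binary.PropositionalEquality using (_≡_; _≢_)
open import Relation.Binary.Construct.Closure.ReflexiveTransitive using (Star)
open import Function.Bundles using (_⇔_)
open import Data.Fin.Subset using (Subset; _∈_; _∉_; _⊆_; ⁅_⁆; ⊥)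

cycPairs : {A : Set} → List A → List (A × A)
cycPairs [] = []
cycPairs (x ∷ xs) = go xs x
  where
  go : _ → _ → _
  go []       y = (y , x) ∷ []
  go (z ∷ zs) y = (y , z) ∷ go zs z

PDCyc : {A : Set} → (A → A → Set) → (A → A → Set) → List A → Set
PDCyc step dstep vs =
  All (λ p → step (proj₁ p) (proj₂ p)) (cycPairs vs)
  × Any (λ p → dstep (proj₁ p) (proj₂ p)) (cycPairs vs)

record ChainGraph (n : ℕ) : Set where
  field
    und : Fin n → Fin n → Bool
    dir : Fin n → Fin n → Bool   -- u → w
    und-irrefl : ∀ v → und v v ≡ false
    und-sym    : ∀ u w → und u w ≡ und w u
    dir-irrefl : ∀ v → dir v v ≡ false
    und-dir-excl : ∀ u w → T (und u w) → ¬ T (dir u w)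
    dir-asym     : ∀ u w → T (dir u w) → ¬ T (dir w u)
    noPDCycle : ∀ (vs : List (Fin n)) → Unique vs →
      ¬ PDCyc (λ a b → T (und a b) ⊎ T (dir a b)) (λ a b → T (dir a b)) vs

Hyperedge : ℕ → Set
Hyperedge n = Subset n × Subset n

Tl Hd : ∀ {n} → Hyperedge n → Subset n
Tl = proj₁
Hd = proj₂

Hypergraph : ℕ → Set₁
Hypergraph n = Hyperedge n → Set

module _ {n : ℕ} (E : Hypergraph n) where

  PaH : Fin n → Fin n → Set
  PaH u v = u ≢ v × Σ (Hyperedge n) (λ h → E h × u ∈ Tl h × v ∈ Hd h)

  NbH : Fin n → Fin n → Set
  NbH u v = u ≢ v × Σ (Hyperedge n) (λ h → E h × u ∈ Hd h × v ∈ Hd h)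

  ShadowUnd : Fin n → Fin n → Set
  ShadowUnd u w = u ≢ w × Σ (Hyperedge n) (λ h → E h × u ∈ Hd h × w ∈ Hd h)

  ShadowDir : Fin n → Fin n → Set
  ShadowDir x y = Σ (Hyperedge n) (λ h → E h × x ∈ Tl h × y ∈ Hd h)

  IsDAH : Set
  IsDAH =
    (∀ h → E h → ∀ x → x ∈ Tl h → x ∉ Hd h)
    × (∀ (vs : List (Fin n)) → ¬ PDCyc (λ a b → NbH a b ⊎ PaH a b) PaH vs)

module Canonical {n : ℕ} (G : ChainGraph n) where
  open ChainGraph G

  Clique : (Fin n → Set) → Subset n → Set
  Clique P K = (∀ x → x ∈ K → P x)
             × (∀ u w → u ∈ K → w ∈ K → u ≢ w → T (und u w))

  MaxClique : (Fin n → Set) → Subset n → Set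
  MaxClique P K = Clique P K × (∀ K' → Clique P K' → K ⊆ K' → K' ⊆ K)

  PhaseIa : Hypergraph n
  PhaseIa h = Σ (Fin n) λ v → Tl h ≡ ⁅ v ⁆ × MaxClique (λ w → T (dir v w)) (Hd h)

  PhaseI : Hypergraph n
  PhaseI h = PhaseIa h
           ⊎ (Tl h ≡ ⊥ × MaxClique (λ _ → Unit) (Hd h)
              × (∀ h' → PhaseIa h' → ¬ (Hd h ⊆ Hd h')))

  ChainComp : Subset n → Set
  ChainComp τ = Σ (Fin n) (λ u → u ∈ τ)
              × (∀ u w → u ∈ τ → (w ∈ τ ⇔ Star (λ a b → T (und a b)) u w))

  InCl : Subset n → Fin n → Set
  InCl τ x = x ∈ τ ⊎ Σ (Fin n) (λ v → v ∈ τ × (T (dir x v) ⊎ T (und x v)))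

  HStar : Subset n → Hypergraph n
  HStar τ h = PhaseI h
            × (∀ x → x ∈ Tl h ⊎ x ∈ Hd h → InCl τ x)
            × Σ (Fin n) (λ x → x ∈ Hd h × x ∈ τ)

  -- Phase II: the canonical LWF DAH (F ranges over nonempty families)
  canonicalLWF : Hypergraph n
  canonicalLWF h =
    Σ (Subset n) λ τ → ChainComp τ ×
    Σ (Hyperedge n) λ f → Σ (List (Hyperedge n)) λ fs →
      All (HStar τ) (f ∷ fs)
      × (∀ x → x ∈ Hd h ⇔ All (λ g → x ∈ Hd g) (f ∷ fs))
      × (∀ x → x ∈ Tl h ⇔
           Σ (Hyperedge n) (λ g → HStar τ g × Hd h ⊆ Hd g × x ∈ Tl g))

-- Soundness: Phase I heads are cliques of G whose tails consist of common
-- parents; Phase II intersects heads and unions tails, so co-head pairs of H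
-- are undirected edges of G and tail-to-head pairs directed ones.  A partially
-- directed cycle of H is then a partially directed closed walk of G, which
-- contains one of distinct vertices (SimpleCycles) -- impossible in G.
-- Completeness: for u → w (resp. u - w) a maximal clique among the children of
-- u containing w (resp. a Phase I hyperedge over a maximal clique containing
-- u, w) meets a chain component τ, and the one-element family {g} ⊆ H*_τ gives
-- a Phase II hyperedge with head Hd g and tail the common parents of Hd g.

module Submission where

open import Defs
open import Data.Nat using (ℕ)
open import Data.Fin using (Fin; _≟_)
open import Data.Fin.Properties using (any?; all?)
open import Data.Fin.Subset using (Subset; _∈_; _∉_; _⊆_; _⊃_; ⁅_⁆; ⊥; _∪_)
open import Data.Fin.Subset.Properties
  using (_∈?_; x∈⁅x⁆; x∈⁅y⁆⇒x≡y; ∉⊥; x∈p∪q⁻; x∈p∪q⁺; p⊆p∪q)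
open import Data.Fin.Subset.Induction using (Acc; acc; ⊃-wellFounded)
open import Data.Bool using (T)
open import Data.Bool.Properties using (T-≡)
open import Data.Vec using (tabulate)
open import Data.Vec.Properties using (lookup∘tabulate; []=⇒lookup; lookup⇒[]=)
open import Data.List using (List; []; _∷_; drop)
open import Data.List.Relation.Unary.All using (All; []; _∷_) renaming (map to All-map)
open import Data.List.Relation.Unary.Any using (Any; here; there) renaming (map to Any-map)
open import Data.List.Relation.Unary.AllPairs using ([]; _∷_)
open import Data.List.Relation.Unary.Unique.Propositional using (Unique)
open import Data.List.Relation.Unary.All.Properties.Core using (¬Any⇒All¬)
open import Data.Product using (_×_; _,_; Σ; ∃; proj₁; proj₂)
open import Data.Sum using (_⊎_; inj₁; inj₂)
open import Data.Empty using (⊥-elim)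
open import Data.Unit using (tt) renaming (⊤ to Unit)
open import Function using (id; _∘_)
open import Function.Bundles using (_⇔_; mk⇔; Equivalence)
open import Relation.Nullary using (¬_; Dec; yes; no)
open import Relation.Nullary.Decidable using (_×-dec_; _→-dec_; ¬?; T?; isYes; toWitness; fromWitness)
open import Relation.Binary.Definitions using (DecidableEquality)
open import Relation.Binary.PropositionalEquality
  using (_≡_; _≢_; refl; sym; trans; subst; ≢-sym)
open import Relation.Binary.Construct.Closure.ReflexiveTransitive
  using (Star; ε; _◅_; _◅◅_; reverse)

-- Saturation: starting from R, keep adding points x ∉ R allowed by a
-- decidable rule Add while preserving an invariant, until no point can be
-- added.  This terminates because each step produces a strict superset and
-- _⊃_ is well founded on subsets of Fin n.
module Saturation {n : ℕ}
    (Add  : Subset n → Fin n → Set)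
    (Add? : ∀ R x → Dec (Add R x))
    (Inv  : Subset n → Set)
    (step : ∀ R x → Inv R → Add R x → Inv (R ∪ ⁅ x ⁆)) where

  Saturated : Subset n → Subset n → Set
  Saturated R R' = R ⊆ R' × Inv R' × (∀ x → x ∉ R' → ¬ Add R' x)

  insert-⊃ : ∀ (R : Subset n) x → x ∉ R → (R ∪ ⁅ x ⁆) ⊃ R
  insert-⊃ R x x∉R = p⊆p∪q ⁅ x ⁆ , x , x∈p∪q⁺ (inj₂ (x∈⁅x⁆ x)) , x∉R

  saturate-acc : ∀ R → Acc _⊃_ R → Inv R → Σ (Subset n) (Saturated R)
  saturate-acc R (acc rec) inv with any? (λ x → ¬? (x ∈? R) ×-dec Add? R x)
  ... | no stuck = R , id , inv , λ x x∉R added → stuck (x , x∉R , added)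
  ... | yes (x , x∉R , added)
      with saturate-acc (R ∪ ⁅ x ⁆) (rec (insert-⊃ R x x∉R)) (step R x inv added)
  ...   | R' , R∪x⊆R' , inv' , closed = R' , R∪x⊆R' ∘ p⊆p∪q ⁅ x ⁆ , inv' , closed

  saturate : ∀ R → Inv R → Σ (Subset n) (Saturated R)
  saturate R = saturate-acc R (⊃-wellFounded R)

⟦_⟧ : ∀ {n} {P : Fin n → Set} → (∀ x → Dec (P x)) → Subset n
⟦ P? ⟧ = tabulate (λ x → isYes (P? x))

∈⟦⟧ : ∀ {n} {P : Fin n → Set} (P? : ∀ x → Dec (P x)) x → x ∈ ⟦ P? ⟧ ⇔ P x
∈⟦⟧ P? x = mk⇔
  (λ x∈ → toWitness {a? = P? x}
            (Equivalence.from T-≡ (trans (sym (lookup∘tabulate _ x)) ([]=⇒lookup x∈))))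
  (λ px → lookup⇒[]= x _
            (trans (lookup∘tabulate _ x) (Equivalence.to T-≡ (fromWitness {a? = P? x} px))))

-- Every partially directed closed walk (w.r.t. a step relation S containing a
-- directed-step relation D) contains a partially directed cycle of distinct
-- vertices.  This is what lets the acyclicity of H, stated for arbitrary
-- cyclic sequences, be reduced to that of G, stated for duplicate-free ones.
module SimpleCycles {A : Set} (_≟ᴬ_ : DecidableEquality A)
    (S D : A → A → Set) (D⇒S : ∀ {a b} → D a b → S a b) where

  open import Data.List.Membership.Propositional using () renaming (_∈_ to _∈ₗ_)
  open import Data.List.Membership.DecPropositional _≟ᴬ_ using () renaming (_∈?_ to _∈ₗ?_)

  Steps : (A → A → Set) → List (A × A) → Set
  Steps R = All (λ p → R (proj₁ p) (proj₂ p))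

  SomeStep : (A → A → Set) → List (A × A) → Set
  SomeStep R = Any (λ p → R (proj₁ p) (proj₂ p))

  -- the steps y → z₁ → … → zₖ → x of the cycle x, y, z₁, …, zₖ after its
  -- first step; note that cycPairs (x ∷ xs) is definitionally laterSteps x x xs
  laterSteps : A → A → List A → List (A × A)
  laterSteps x y zs = drop 1 (cycPairs (x ∷ y ∷ zs))

  steps⇒walk : ∀ x y zs → Steps S (laterSteps x y zs) → Star S y x
  steps⇒walk x y []       (s ∷ [])  = s ◅ ε
  steps⇒walk x y (z ∷ zs) (s ∷ ss)  = s ◅ steps⇒walk x z zs ss

  splitAtDirected : ∀ x y zs → Steps S (laterSteps x y zs) → SomeStep D (laterSteps x y zs) →
                    Σ A λ a → Σ A λ b → D a b × Star S y a × Star S b x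
  splitAtDirected x y []       (s ∷ [])  (here a→b) = y , x , a→b , ε , ε
  splitAtDirected x y (z ∷ zs) (s ∷ ss)  (here a→b) = y , z , a→b , ε , steps⇒walk x z zs ss
  splitAtDirected x y (z ∷ zs) (s ∷ ss)  (there d)
    with splitAtDirected x z zs ss d
  ... | a , b , a→b , z⇝a , b⇝x = a , b , a→b , s ◅ z⇝a , b⇝x

  SimplePath : A → A → List A → Set
  SimplePath a b zs = Steps S (laterSteps a b zs) × Unique (b ∷ zs) × All (a ≢_) (b ∷ zs)

  dropTo : ∀ {a} b c zs → b ∈ₗ (c ∷ zs) → SimplePath a c zs → Σ (List A) (SimplePath a b)
  dropTo b c zs       (here refl) path = zs , path
  dropTo b c (z ∷ zs) (there b∈)  (_ ∷ ss , _ ∷ uniq , _ ∷ avoid) =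
    dropTo b z zs b∈ (ss , uniq , avoid)

  walk⇒simplePath : ∀ {a b} → Star S b a → b ≢ a → Σ (List A) (SimplePath a b)
  walk⇒simplePath ε b≢a = ⊥-elim (b≢a refl)
  walk⇒simplePath {a} {b} (_◅_ {j = c} s c⇝a) b≢a with c ≟ᴬ a
  ... | yes refl = [] , s ∷ [] , [] ∷ [] , ≢-sym b≢a ∷ []
  ... | no c≢a with walk⇒simplePath c⇝a c≢a
  ...   | zs , path with b ∈ₗ? (c ∷ zs)
  ...     | yes b∈ = dropTo b c zs b∈ path
  ...     | no b∉ with path
  ...       | ss , uniq , avoid =
    c ∷ zs , s ∷ ss , ¬Any⇒All¬ _ b∉ ∷ uniq , ≢-sym b≢a ∷ avoid

  simpleCycle : ∀ vs → PDCyc S D vs → Σ (List A) λ ws → Unique ws × PDCyc S D ws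
  simpleCycle []       (_ , ())
  simpleCycle (x ∷ xs) (steps , directed) with splitAtDirected x x xs steps directed
  ... | a , b , a→b , x⇝a , b⇝x with b ≟ᴬ a
  ...   | yes refl = b ∷ [] , [] ∷ [] , D⇒S a→b ∷ [] , here a→b
  ...   | no b≢a with walk⇒simplePath (b⇝x ◅◅ x⇝a) b≢a
  ...     | zs , ss , uniq , avoid = a ∷ b ∷ zs , avoid ∷ uniq , D⇒S a→b ∷ ss , here a→b

module CanonicalLWF {n : ℕ} (G : ChainGraph n) where
  open ChainGraph G
  open Canonical G

  E : Hypergraph n
  E = canonicalLWF

  und-sym′ : ∀ {a b} → T (und a b) → T (und b a)
  und-sym′ {a} {b} = subst T (und-sym a b)

  und⇒≢ : ∀ {a b} → T (und a b) → a ≢ b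
  und⇒≢ {a} a—a refl = subst T (und-irrefl a) a—a

  dir⇒≢ : ∀ {a b} → T (dir a b) → a ≢ b
  dir⇒≢ {a} a→a refl = subst T (dir-irrefl a) a→a

  ∈⁅⁆ : ∀ {x y : Fin n} → x ∈ ⁅ y ⁆ → x ≡ y
  ∈⁅⁆ {y = y} = x∈⁅y⁆⇒x≡y y

  Complete : Subset n → Set
  Complete K = ∀ u w → u ∈ K → w ∈ K → u ≢ w → T (und u w)

  complete⊆component : ∀ {τ K t} → ChainComp τ → t ∈ τ → Complete K → t ∈ K → K ⊆ τ
  complete⊆component {t = t} (_ , reach) t∈τ complete t∈K {k} k∈K with k ≟ t
  ... | yes refl = t∈τ
  ... | no k≢t = Equivalence.from (reach t k t∈τ) (complete t k t∈K k∈K (≢-sym k≢t) ◅ ε)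

  module _ (u : Fin n) where
    AdjacentTo : Subset n → Fin n → Set
    AdjacentTo R x = ∃ λ y → y ∈ R × T (und y x)

    ReachableFrom : Subset n → Set
    ReachableFrom R = ∀ w → w ∈ R → Star (λ a b → T (und a b)) u w

    reach-step : ∀ R x → ReachableFrom R → AdjacentTo R x → ReachableFrom (R ∪ ⁅ x ⁆)
    reach-step R x reach (y , y∈R , y—x) w w∈ with x∈p∪q⁻ R ⁅ x ⁆ w∈
    ... | inj₁ w∈R = reach w w∈R
    ... | inj₂ w∈x with ∈⁅⁆ w∈x
    ...   | refl = reach y y∈R ◅◅ (y—x ◅ ε)

    open Saturation AdjacentTo (λ R x → any? (λ y → y ∈? R ×-dec T? (und y x)))
                    ReachableFrom reach-step

    componentOf : Σ (Subset n) λ τ → ChainComp τ × u ∈ τ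
    componentOf with saturate ⁅ u ⁆ (λ w w∈ → subst (Star _ u) (sym (∈⁅⁆ w∈)) ε)
    ... | τ , u⊆τ , reach , closed =
      τ , ((u , u∈τ) , λ a w a∈τ → mk⇔ (λ w∈τ → reverse und-sym′ (reach a a∈τ) ◅◅ reach w w∈τ)
                                        (closedUnder a∈τ)) , u∈τ
      where
      u∈τ : u ∈ τ
      u∈τ = u⊆τ (x∈⁅x⁆ u)
      closedUnder : ∀ {a w} → a ∈ τ → Star (λ a b → T (und a b)) a w → w ∈ τ
      closedUnder a∈τ ε = a∈τ
      closedUnder {a} a∈τ (_◅_ {j = b} a—b b⇝w) with b ∈? τ
      ... | yes b∈τ = closedUnder b∈τ b⇝w
      ... | no b∉τ = ⊥-elim (closed b b∉τ (a , a∈τ , a—b))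

  module _ {P : Fin n → Set} where
    Extends : Subset n → Fin n → Set
    Extends K x = P x × (∀ y → y ∈ K → y ≢ x → T (und x y))

    clique-singleton : ∀ x → P x → Clique P ⁅ x ⁆
    clique-singleton x px =
        (λ z z∈ → subst P (sym (∈⁅⁆ z∈)) px)
      , λ a b a∈ b∈ a≢b → ⊥-elim (a≢b (trans (∈⁅⁆ a∈) (sym (∈⁅⁆ b∈))))

    clique-insert : ∀ K x → Clique P K → Extends K x → Clique P (K ∪ ⁅ x ⁆)
    clique-insert K x (inP , complete) (px , joined) = inP′ , complete′
      where
      inP′ : ∀ z → z ∈ K ∪ ⁅ x ⁆ → P z
      inP′ z z∈ with x∈p∪q⁻ K ⁅ x ⁆ z∈
      ... | inj₁ z∈K = inP z z∈K
      ... | inj₂ z∈x = subst P (sym (∈⁅⁆ z∈x)) px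
      complete′ : Complete (K ∪ ⁅ x ⁆)
      complete′ a b a∈ b∈ a≢b with x∈p∪q⁻ K ⁅ x ⁆ a∈ | x∈p∪q⁻ K ⁅ x ⁆ b∈
      ... | inj₁ a∈K | inj₁ b∈K = complete a b a∈K b∈K a≢b
      ... | inj₁ a∈K | inj₂ b∈x with ∈⁅⁆ b∈x
      ...   | refl = und-sym′ (joined a a∈K a≢b)
      complete′ a b a∈ b∈ a≢b | inj₂ a∈x | inj₁ b∈K with ∈⁅⁆ a∈x
      ...   | refl = joined b b∈K (≢-sym a≢b)
      complete′ a b a∈ b∈ a≢b | inj₂ a∈x | inj₂ b∈x =
        ⊥-elim (a≢b (trans (∈⁅⁆ a∈x) (sym (∈⁅⁆ b∈x))))

    unextendable⇒maximal : ∀ {K} → (∀ x → x ∉ K → ¬ Extends K x) →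
                           ∀ K' → Clique P K' → K ⊆ K' → K' ⊆ K
    unextendable⇒maximal {K} closed K' (inP , complete) K⊆K' {z} z∈K' with z ∈? K
    ... | yes z∈K = z∈K
    ... | no z∉K = ⊥-elim (closed z z∉K
                     (inP z z∈K' , λ y y∈K y≢z → complete z y z∈K' (K⊆K' y∈K) (≢-sym y≢z)))

  module _ {P : Fin n → Set} (P? : ∀ x → Dec (P x)) where
    open Saturation Extends
                    (λ K x → P? x ×-dec all? (λ y → y ∈? K →-dec (¬? (y ≟ x) →-dec T? (und x y))))
                    (Clique P) clique-insert

    extendToMaxClique : ∀ K → Clique P K → Σ (Subset n) λ K' → K ⊆ K' × MaxClique P K'
    extendToMaxClique K clique with saturate K clique
    ... | K' , K⊆K' , clique′ , closed = K' , K⊆K' , clique′ , unextendable⇒maximal closed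

  phaseI-head : ∀ {g} → PhaseI g → Complete (Hd g)
  phaseI-head (inj₁ (_ , _ , ((_ , complete) , _)))     = complete
  phaseI-head (inj₂ (_ , ((_ , complete) , _) , _))     = complete

  phaseI-tail : ∀ {g x y} → PhaseI g → x ∈ Tl g → y ∈ Hd g → T (dir x y)
  phaseI-tail (inj₁ (_ , Tl≡v , ((children , _) , _))) x∈ y∈
    with ∈⁅⁆ (subst (_ ∈_) Tl≡v x∈)
  ... | refl = children _ y∈
  phaseI-tail (inj₂ (Tl≡∅ , _)) x∈ _ = ⊥-elim (∉⊥ (subst (_ ∈_) Tl≡∅ x∈))

  lwf-head : ∀ {h} → E h → Complete (Hd h)
  lwf-head (_ , _ , _ , _ , (f* ∷ _) , head , _) a b a∈ b∈ a≢b
    with Equivalence.to (head a) a∈ | Equivalence.to (head b) b∈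
  ... | a∈f ∷ _ | b∈f ∷ _ = phaseI-head (proj₁ f*) a b a∈f b∈f a≢b

  lwf-tail : ∀ {h x y} → E h → x ∈ Tl h → y ∈ Hd h → T (dir x y)
  lwf-tail (_ , _ , _ , _ , _ , _ , tail) x∈ y∈ with Equivalence.to (tail _) x∈
  ... | _ , g* , Hd⊆ , x∈g = phaseI-tail (proj₁ g*) x∈g (Hd⊆ y∈)

  phaseI⇒HStar : ∀ {τ g t} → ChainComp τ → PhaseI g → t ∈ Hd g → t ∈ τ → HStar τ g
  phaseI⇒HStar {τ} {g} {t} cc g₁ t∈g t∈τ = g₁ , inClosure , t , t∈g , t∈τ
    where
    inClosure : ∀ x → x ∈ Tl g ⊎ x ∈ Hd g → InCl τ x
    inClosure x (inj₁ x∈T) = inj₂ (t , t∈τ , inj₁ (phaseI-tail g₁ x∈T t∈g))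
    inClosure x (inj₂ x∈H) = inj₁ (complete⊆component cc t∈τ (phaseI-head g₁) t∈g x∈H)

  CommonParent : Subset n → Fin n → Set
  CommonParent B x = ∀ y → y ∈ B → T (dir x y)

  commonParent? : ∀ B x → Dec (CommonParent B x)
  commonParent? B x = all? (λ y → y ∈? B →-dec T? (dir x y))

  commonParents : Subset n → Subset n
  commonParents B = ⟦ commonParent? B ⟧

  -- Phase II applied to the one-element family {g} ⊆ H*_τ: its tail, the union
  -- of the tails of H*_τ-hyperedges whose heads contain Hd g, is exactly the
  -- set of common parents of Hd g
  HStar⇒lwf : ∀ {τ g} → ChainComp τ → HStar τ g → E (commonParents (Hd g) , Hd g)
  HStar⇒lwf {τ} {g} cc g*@(g₁ , _ , t , t∈g , t∈τ) = τ , cc , g , [] , g* ∷ [] , head , tail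
    where
    head : ∀ x → x ∈ Hd g ⇔ All (λ g′ → x ∈ Hd g′) (g ∷ [])
    head x = mk⇔ (_∷ []) (λ { (x∈ ∷ []) → x∈ })

    -- a common parent x of Hd g is the tail of the Phase I hyperedge
    -- ({x}, K) with K ⊇ Hd g a maximal clique among the children of x
    parentEdge : ∀ x → CommonParent (Hd g) x →
                 Σ (Hyperedge n) (λ g′ → HStar τ g′ × Hd g ⊆ Hd g′ × x ∈ Tl g′)
    parentEdge x x→Hd with extendToMaxClique (λ w → T? (dir x w)) (Hd g) (x→Hd , phaseI-head g₁)
    ... | K , Hd⊆K , maxK =
      (⁅ x ⁆ , K) , phaseI⇒HStar cc (inj₁ (x , refl , maxK)) (Hd⊆K t∈g) t∈τ , Hd⊆K , x∈⁅x⁆ x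

    tail : ∀ x → x ∈ commonParents (Hd g) ⇔
                 Σ (Hyperedge n) (λ g′ → HStar τ g′ × Hd g ⊆ Hd g′ × x ∈ Tl g′)
    tail x = mk⇔ (parentEdge x ∘ Equivalence.to (∈⟦⟧ _ x))
                 (λ { (g′ , g′* , Hd⊆ , x∈g′) → Equivalence.from (∈⟦⟧ _ x)
                        (λ y y∈ → phaseI-tail (proj₁ g′*) x∈g′ (Hd⊆ y∈)) })

  -- every maximal clique of the undirected part lies in the head of a
  -- Phase I hyperedge: either some common parent v has it among its
  -- children (first step), or it is added itself (second step)
  maxClique⇒phaseI : ∀ {K} → MaxClique (λ _ → Unit) K →
                     Σ (Hyperedge n) λ g → PhaseI g × K ⊆ Hd g
  maxClique⇒phaseI {K} maxK@((_ , complete) , _) with any? (commonParent? K)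
  ... | yes (v , v→K) with extendToMaxClique (λ w → T? (dir v w)) K (v→K , complete)
  ...   | K′ , K⊆K′ , maxK′ = (⁅ v ⁆ , K′) , inj₁ (v , refl , maxK′) , K⊆K′
  maxClique⇒phaseI {K} maxK | no noParent = (⊥ , K) , inj₂ (refl , maxK , notBelow) , id
    where
    notBelow : ∀ h′ → PhaseIa h′ → ¬ (K ⊆ Hd h′)
    notBelow _ (v , _ , ((children , _) , _)) K⊆ = noParent (v , λ y y∈K → children y (K⊆ y∈K))

  dir⇒lwf : ∀ {u w} → T (dir u w) → ShadowDir E u w
  dir⇒lwf {u} {w} u→w with componentOf w
  ... | τ , cc , w∈τ
      with extendToMaxClique (λ z → T? (dir u z)) ⁅ w ⁆ (clique-singleton w u→w)
  ...   | K , w⊆K , maxK@((u→K , _) , _) =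
    (commonParents K , K) ,
    HStar⇒lwf cc (phaseI⇒HStar cc (inj₁ (u , refl , maxK)) (w⊆K (x∈⁅x⁆ w)) w∈τ) ,
    Equivalence.from (∈⟦⟧ _ u) u→K , w⊆K (x∈⁅x⁆ w)

  edgeClique : ∀ {u w} → T (und u w) → Clique (λ _ → Unit) (⁅ u ⁆ ∪ ⁅ w ⁆)
  edgeClique {u} {w} u—w =
    clique-insert ⁅ u ⁆ w (clique-singleton u tt)
      (tt , λ y y∈u _ → subst (λ y → T (und w y)) (sym (∈⁅⁆ y∈u)) (und-sym′ u—w))

  und⇒lwf : ∀ {u w} → T (und u w) → Σ (Hyperedge n) λ h → E h × u ∈ Hd h × w ∈ Hd h
  und⇒lwf {u} {w} u—w with componentOf u
  ... | τ , cc , u∈τ with extendToMaxClique (λ _ → yes tt) (⁅ u ⁆ ∪ ⁅ w ⁆) (edgeClique u—w)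
  ...   | K , uw⊆K , maxK with maxClique⇒phaseI maxK
  ...     | g , g₁ , K⊆g =
    (commonParents (Hd g) , Hd g) , HStar⇒lwf cc (phaseI⇒HStar cc g₁ u∈g u∈τ) , u∈g , w∈g
    where
    u∈g : u ∈ Hd g
    u∈g = K⊆g (uw⊆K (x∈p∪q⁺ (inj₁ (x∈⁅x⁆ u))))
    w∈g : w ∈ Hd g
    w∈g = K⊆g (uw⊆K (x∈p∪q⁺ (inj₂ (x∈⁅x⁆ w))))

  nb⇔ : ∀ {u w} → T (und u w) ⇔ NbH E u w
  nb⇔ = mk⇔ (λ u—w → und⇒≢ u—w , und⇒lwf u—w)
            (λ { (u≢w , _ , e , u∈ , w∈) → lwf-head e _ _ u∈ w∈ u≢w })

  shadowDir⇔ : ∀ {u w} → T (dir u w) ⇔ ShadowDir E u w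
  shadowDir⇔ = mk⇔ dir⇒lwf (λ { (_ , e , u∈ , w∈) → lwf-tail e u∈ w∈ })

  pa⇔ : ∀ {u w} → T (dir u w) ⇔ PaH E u w
  pa⇔ = mk⇔ (λ u→w → dir⇒≢ u→w , Equivalence.to shadowDir⇔ u→w)
            (Equivalence.from shadowDir⇔ ∘ proj₂)

  -- H is a DAH: tails and heads are disjoint since tail-to-head pairs are
  -- directed edges, and a partially directed cycle of H would be a partially
  -- directed closed walk of G, hence would contain one of distinct vertices
  lwf-isDAH : IsDAH E
  lwf-isDAH = disjoint , acyclic
    where
    open SimpleCycles _≟_ (λ a b → T (und a b) ⊎ T (dir a b)) (λ a b → T (dir a b)) inj₂

    disjoint : ∀ h → E h → ∀ x → x ∈ Tl h → x ∉ Hd h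
    disjoint h e x x∈T x∈H = dir⇒≢ (lwf-tail e x∈T x∈H) refl

    lwfStep⇒edge : ∀ {a b} → NbH E a b ⊎ PaH E a b → T (und a b) ⊎ T (dir a b)
    lwfStep⇒edge (inj₁ ab) = inj₁ (Equivalence.from nb⇔ ab)
    lwfStep⇒edge (inj₂ ab) = inj₂ (Equivalence.from pa⇔ ab)

    acyclic : ∀ vs → ¬ PDCyc (λ a b → NbH E a b ⊎ PaH E a b) (PaH E) vs
    acyclic vs (steps , directed)
      with simpleCycle vs (All-map lwfStep⇒edge steps , Any-map (Equivalence.from pa⇔) directed)
    ... | ws , unique , cycle = noPDCycle ws unique cycle

lemma1 : ∀ (n : ℕ) (G : ChainGraph n) →
    let open ChainGraph G
        E = Canonical.canonicalLWF G
    in (∀ v u → (T (und u v) ⇔ NbH E u v) × (T (dir u v) ⇔ PaH E u v))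
       × (∀ u w → (T (und u w) ⇔ ShadowUnd E u w) × (T (dir u w) ⇔ ShadowDir E u w))
       × IsDAH E
-- (ii) restates (i): the undirected edges of the shadow are the neighbour
-- pairs of H, and its directed edges are the parent pairs without u ≢ w
lemma1 _ G = (λ v u → nb⇔ , pa⇔) , (λ u w → nb⇔ , shadowDir⇔) , lwf-isDAH
  where
  open CanonicalLWF G
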